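{- Let $\mathbf{A}\in\{0,1\}^{m\times n}$ be represented in Compressed Binary Matrix (CBM) format (as defined in the context), and let $\vec{v}\in\mathbb{R}^n$. Consider computing $\vec{u}=\mathbf{A}\vec{v}$ by traversing the chain of compression $T$ in topological order from the root $0$ and, for each tree edge $(y,x)$ with $y$ the parent of $x$, setting $u_x\gets u_y+(\Delta^+_{x,y}\cdot\vec{v})-(\Delta^-_{x,y}\cdot\vec{v})$ (where $u_0=0$ and, for a set $S$ of column indices, $S\cdot\vec{v}=\sum_{j\in S}v_j$). Count the cost of the update for $x$ as $1+|\Delta^+_{x,y}|+|\Delta^-_{x,y}|$ scalar operations if $y\neq 0$, and as $|\Delta^+_{x,0}|=\mathbf{nnz}(\vec{a}_x)$ scalar operations if $y=0$ (the addition of $u_0=0$ being omitted). Then the total number of scalar operations is at most $\mathbf{nnz}(\mathbf{A})$, the number of scalar operations required by classic sparse-format matrix-vector multiplication.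
   Context: Identify each row $\vec{a}_x$ ($x=1,\dots,m$) of $\mathbf{A}$ with the set of column indices of its nonzero entries, and add a virtual null row $\vec{a}_0=\emptyset$. The extended distance graph $G$ of $\mathbf{A}$ is the complete undirected weighted graph on the vertex set $\{0,1,\dots,m\}$ in which the edge $\{x,y\}$ has weight equal to the Hamming distance $|\vec{a}_x\setminus\vec{a}_y|+|\vec{a}_y\setminus\vec{a}_x|$ (so the edge $\{0,x\}$ has weight $\mathbf{nnz}(\vec{a}_x)$). The CBM format uses as chain of compression a minimum spanning tree $T$ of $G$ rooted at vertex $0$, where the minimum spanning tree algorithm breaks ties in favour of edges out of the virtual vertex $0$ (so that whenever an edge $(y,x)$ into $x$ and the edge $(0,x)$ have equal weight, the edge from $0$ is selected). For each tree edge $(y,x)$ with $y$ the parent of $x$ it stores $\Delta^+_{x,y}=\vec{a}_x\setminus\vec{a}_y$ and $\Delta^-_{x,y}=\vec{a}_y\setminus\vec{a}_x$, so that $\vec{a}_x\cdot\vec{v}=\vec{a}_y\cdot\vec{v}+\Delta^+_{x,y}\cdot\vec{v}-\Delta^-_{x,y}\cdot\vec{v}$. -}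

module Defs where

open import Data.Nat using (ℕ; zero; suc; _+_; _≤_)
open import Data.Fin using (Fin) renaming (zero to fzero; suc to fsuc)
open import Data.Fin.Subset using (Subset; ∣_∣; _─_; ⊥)
open import Data.Vec using (sum; tabulate)
open import Data.Product using (∃; _×_)
open import Relation.Binary.PropositionalEquality using (_≡_)

-- A binary m×n matrix: row x is the set of column indices of its nonzero entries.
BinMatrix : ℕ → ℕ → Set
BinMatrix m n = Fin m → Subset n

Σ[_] : {m : ℕ} → (Fin m → ℕ) → ℕ
Σ[ f ] = sum (tabulate f)

nnz : {n : ℕ} → Subset n → ℕ
nnz = ∣_∣

nnzMat : {m n : ℕ} → BinMatrix m n → ℕ
nnzMat A = Σ[ (λ x → nnz (A x)) ]

-- extended rows: vertex 0 is the virtual null row, vertex (suc x) is row x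
extRow : {m n : ℕ} → BinMatrix m n → Fin (suc m) → Subset n
extRow A fzero    = ⊥
extRow A (fsuc x) = A x

Δ⁺ : {n : ℕ} → Subset n → Subset n → Subset n
Δ⁺ ax ay = ax ─ ay

Δ⁻ : {n : ℕ} → Subset n → Subset n → Subset n
Δ⁻ ax ay = ay ─ ax

hamming : {n : ℕ} → Subset n → Subset n → ℕ
hamming a b = ∣ a ─ b ∣ + ∣ b ─ a ∣

weight : {m n : ℕ} → BinMatrix m n → Fin (suc m) → Fin (suc m) → ℕ
weight A x y = hamming (extRow A x) (extRow A y)

-- A spanning tree of the complete graph on {0,…,m} rooted at 0 is given by a
-- parent function on the non-root vertices {1,…,m} (vertex fsuc x has parent p x)
-- such that following parents from any vertex eventually reaches the root 0.
Parent : ℕ → Set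
Parent m = Fin m → Fin (suc m)

parentExt : {m : ℕ} → Parent m → Fin (suc m) → Fin (suc m)
parentExt p fzero    = fzero
parentExt p (fsuc x) = p x

iter : {A : Set} → ℕ → (A → A) → A → A
iter zero    f a = a
iter (suc k) f a = f (iter k f a)

IsRootedSpanningTree : {m : ℕ} → Parent m → Set
IsRootedSpanningTree {m} p = (v : Fin (suc m)) → ∃ λ k → iter k (parentExt p) v ≡ fzero

treeWeight : {m n : ℕ} → BinMatrix m n → Parent m → ℕ
treeWeight A p = Σ[ (λ x → weight A (fsuc x) (p x)) ]

isNonRoot : {m : ℕ} → Fin (suc m) → ℕ
isNonRoot fzero    = 0
isNonRoot (fsuc _) = 1

nonRootEdges : {m : ℕ} → Parent m → ℕ
nonRootEdges p = Σ[ (λ x → isNonRoot (p x)) ]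

-- Minimum spanning tree of the extended distance graph with ties broken in favour
-- of edges out of 0: minimal w.r.t. the edge weights w(e) + ε·[0 ∉ e] for
-- infinitesimal ε > 0, i.e. lexicographically minimal in
-- (total weight, number of edges not incident to 0) among all spanning trees.
IsCBMTree : {m n : ℕ} → BinMatrix m n → Parent m → Set
IsCBMTree {m} A p =
  IsRootedSpanningTree p ×
  ((q : Parent m) → IsRootedSpanningTree q → treeWeight A p ≤ treeWeight A q) ×
  ((q : Parent m) → IsRootedSpanningTree q → treeWeight A q ≡ treeWeight A p →
     nonRootEdges p ≤ nonRootEdges q)

updateCost : {m n : ℕ} → BinMatrix m n → Fin m → Fin (suc m) → ℕ
updateCost A x fzero    = ∣ Δ⁺ (A x) (extRow A fzero) ∣
updateCost A x (fsuc y) = 1 + ∣ Δ⁺ (A x) (A y) ∣ + ∣ Δ⁻ (A x) (A y) ∣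

cbmCost : {m n : ℕ} → BinMatrix m n → Parent m → ℕ
cbmCost A p = Σ[ (λ x → updateCost A x (p x)) ]

module Submission where

open import Defs
open import Data.Nat using (ℕ; zero; suc; _+_; _≤_; _<_; z≤n)
open import Data.Nat.Properties
  using (≤-reflexive; ≤-trans; +-mono-≤; +-monoˡ-≤; +-cancelˡ-≤; +-cancelʳ-≡; +-assoc; +-identityʳ;
         ≤∧≢⇒<; m+1+n≰m)
open import Data.Nat.Solver using (module +-*-Solver)
open import Data.Fin using (Fin) renaming (zero to fzero; suc to fsuc)
open import Data.Fin.Properties using (_≟_; suc-injective)
open import Data.Fin.Subset using (Subset; ∣_∣; _─_; ⊥)
open import Data.Fin.Subset.Properties using (p─⊥≡p; p─q⊆p; ⊥⊆; ⊆-antisym; ∣⊥∣≡0)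
open import Data.Vec using (sum; tabulate)
open import Data.Vec.Properties using (tabulate-cong)
open import Data.Vec.Functional using (updateAt)
open import Data.Vec.Functional.Properties using (updateAt-updates; updateAt-minimal)
open import Data.Product using (∃; _,_; proj₁; proj₂)
open import Function using (_∘_; const)
open import Relation.Binary.PropositionalEquality
  using (_≡_; _≢_; refl; sym; trans; cong; cong₂; module ≡-Reasoning)
open import Relation.Nullary using (yes; no)

-- Reattaching a row x directly to the virtual root keeps a spanning tree and changes its
-- weight by nnz(a_x) − w(x, parent x). Minimality of the tree therefore gives
-- w(x, parent x) ≤ nnz(a_x); if the parent is a real row and equality held, the rerooted
-- tree would have the same weight and one edge fewer avoiding 0, violating the
-- tie-breaking rule. Hence 1 + w(x, parent x) ≤ nnz(a_x), i.e. every update costs at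
-- most the number of nonzeros of its row.

⊥─p≡⊥ : ∀ {n} (a : Subset n) → ⊥ ─ a ≡ ⊥
⊥─p≡⊥ a = ⊆-antisym (p─q⊆p ⊥ a) ⊥⊆

weight-root : ∀ {m n} (A : BinMatrix m n) (x : Fin m) → weight A (fsuc x) fzero ≡ nnz (A x)
weight-root {n = n} A x = begin
  ∣ A x ─ ⊥ ∣ + ∣ ⊥ ─ A x ∣ ≡⟨ cong₂ _+_ (cong ∣_∣ (p─⊥≡p (A x))) (trans (cong ∣_∣ (⊥─p≡⊥ (A x))) (∣⊥∣≡0 n)) ⟩
  ∣ A x ∣ + 0               ≡⟨ +-identityʳ _ ⟩
  ∣ A x ∣                   ∎
  where open ≡-Reasoning

Σ-cong : ∀ {m} {f g : Fin m → ℕ} → (∀ i → f i ≡ g i) → Σ[ f ] ≡ Σ[ g ]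
Σ-cong f≗g = cong sum (tabulate-cong f≗g)

Σ-mono-≤ : ∀ {m} {f g : Fin m → ℕ} → (∀ i → f i ≤ g i) → Σ[ f ] ≤ Σ[ g ]
Σ-mono-≤ {zero}  f≤g = z≤n
Σ-mono-≤ {suc m} f≤g = +-mono-≤ (f≤g fzero) (Σ-mono-≤ (f≤g ∘ fsuc))

-- Exchanging the single summand at i, with both sides moved so that no subtraction occurs.
Σ-exchange : ∀ {m} (f g : Fin m → ℕ) (i : Fin m) → (∀ j → j ≢ i → f j ≡ g j) →
             Σ[ f ] + g i ≡ Σ[ g ] + f i
Σ-exchange f g fzero f≡g = begin
  f fzero + Σ[ f ∘ fsuc ] + g fzero ≡⟨ cong (λ s → f fzero + s + g fzero) (Σ-cong (λ j → f≡g (fsuc j) λ ())) ⟩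
  f fzero + Σ[ g ∘ fsuc ] + g fzero ≡⟨ solve 3 (λ a b s → a :+ s :+ b := b :+ s :+ a) refl (f fzero) (g fzero) _ ⟩
  g fzero + Σ[ g ∘ fsuc ] + f fzero ∎
  where open ≡-Reasoning; open +-*-Solver
Σ-exchange f g (fsuc i) f≡g = begin
  f fzero + Σ[ f ∘ fsuc ] + g (fsuc i)   ≡⟨ +-assoc (f fzero) _ _ ⟩
  f fzero + (Σ[ f ∘ fsuc ] + g (fsuc i)) ≡⟨ cong₂ _+_ (f≡g fzero λ ()) (Σ-exchange (f ∘ fsuc) (g ∘ fsuc) i (λ j j≢i → f≡g (fsuc j) (j≢i ∘ suc-injective))) ⟩
  g fzero + (Σ[ g ∘ fsuc ] + f (fsuc i)) ≡⟨ +-assoc (g fzero) _ _ ⟨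
  g fzero + Σ[ g ∘ fsuc ] + f (fsuc i)   ∎
  where open ≡-Reasoning

reroot : ∀ {m} → Parent m → Fin m → Parent m
reroot p x = updateAt p x (const fzero)

iter-suc : ∀ {A : Set} k (f : A → A) a → iter (suc k) f a ≡ iter k f (f a)
iter-suc zero    f a = refl
iter-suc (suc k) f a = cong f (iter-suc k f a)

reroot-isRootedSpanningTree : ∀ {m} {p : Parent m} (x : Fin m) →
                              IsRootedSpanningTree p → IsRootedSpanningTree (reroot p x)
reroot-isRootedSpanningTree {p = p} x tree v = reaches (proj₁ (tree v)) v (proj₂ (tree v))
  where
  reaches : ∀ k v → iter k (parentExt p) v ≡ fzero → ∃ λ k′ → iter k′ (parentExt (reroot p x)) v ≡ fzero
  reaches k       fzero    _ = 0 , refl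
  reaches (suc k) (fsuc z) pᵏ⁺¹z≡0 with z ≟ x
  ... | yes refl = 1 , updateAt-updates x p
  ... | no z≢x with reaches k (p z) (trans (sym (iter-suc k (parentExt p) (fsuc z))) pᵏ⁺¹z≡0)
  ...   | k′ , e = suc k′ , (begin
    iter (suc k′) (parentExt (reroot p x)) (fsuc z) ≡⟨ iter-suc k′ _ (fsuc z) ⟩
    iter k′ (parentExt (reroot p x)) (reroot p x z) ≡⟨ cong (iter k′ _) (updateAt-minimal z x p z≢x) ⟩
    iter k′ (parentExt (reroot p x)) (p z)          ≡⟨ e ⟩
    fzero                                           ∎)
    where open ≡-Reasoning

Σ-reroot : ∀ {m} (c : Fin m → Fin (suc m) → ℕ) (p : Parent m) (x : Fin m) →
           Σ[ (λ z → c z (reroot p x z)) ] + c x (p x) ≡ Σ[ (λ z → c z (p z)) ] + c x fzero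
Σ-reroot c p x = begin
  Σ[ (λ z → c z (reroot p x z)) ] + c x (p x) ≡⟨ Σ-exchange _ _ x (λ z z≢x → cong (c z) (updateAt-minimal z x p z≢x)) ⟩
  Σ[ (λ z → c z (p z)) ] + c x (reroot p x x) ≡⟨ cong (λ v → _ + c x v) (updateAt-updates x p) ⟩
  Σ[ (λ z → c z (p z)) ] + c x fzero          ∎
  where open ≡-Reasoning

cbmParent-closer-than-root : ∀ {m n} {A : BinMatrix m n} {p : Parent m} → IsCBMTree A p →
                             ∀ {x y} → p x ≡ fsuc y → weight A (fsuc x) (fsuc y) < nnz (A x)
cbmParent-closer-than-root {A = A} {p} (tree , minWeight , minNonRoot) {x} {y} px≡y =
  ≤∧≢⇒< w≤nnz w≢nnz
  where
  q : Parent _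
  q = reroot p x

  w : ℕ
  w = weight A (fsuc x) (fsuc y)

  weights : treeWeight A q + w ≡ treeWeight A p + nnz (A x)
  weights = begin
    treeWeight A q + w                         ≡⟨ cong (λ v → treeWeight A q + weight A (fsuc x) v) px≡y ⟨
    treeWeight A q + weight A (fsuc x) (p x)   ≡⟨ Σ-reroot (λ z → weight A (fsuc z)) p x ⟩
    treeWeight A p + weight A (fsuc x) fzero   ≡⟨ cong (treeWeight A p +_) (weight-root A x) ⟩
    treeWeight A p + nnz (A x)                 ∎
    where open ≡-Reasoning

  nonRoot : nonRootEdges q + 1 ≡ nonRootEdges p
  nonRoot = begin
    nonRootEdges q + 1                ≡⟨ cong (λ v → nonRootEdges q + isNonRoot v) px≡y ⟨
    nonRootEdges q + isNonRoot (p x)  ≡⟨ Σ-reroot (λ _ → isNonRoot) p x ⟩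
    nonRootEdges p + 0                ≡⟨ +-identityʳ _ ⟩
    nonRootEdges p                    ∎
    where open ≡-Reasoning

  q-tree : IsRootedSpanningTree q
  q-tree = reroot-isRootedSpanningTree x tree

  w≤nnz : w ≤ nnz (A x)
  w≤nnz = +-cancelˡ-≤ (treeWeight A p) _ _
            (≤-trans (+-monoˡ-≤ w (minWeight q q-tree)) (≤-reflexive weights))

  w≢nnz : w ≢ nnz (A x)
  w≢nnz w≡nnz = m+1+n≰m (nonRootEdges q)
    (≤-trans (≤-reflexive nonRoot) (minNonRoot q q-tree sameWeight))
    where
    sameWeight : treeWeight A q ≡ treeWeight A p
    sameWeight = +-cancelʳ-≡ w _ _ (trans weights (cong (treeWeight A p +_) (sym w≡nnz)))

updateCost-≤-nnz : ∀ {m n} {A : BinMatrix m n} {p : Parent m} → IsCBMTree A p →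
                   ∀ x → updateCost A x (p x) ≤ nnz (A x)
updateCost-≤-nnz {A = A} {p} cbm x with p x in px
... | fzero  = ≤-reflexive (cong ∣_∣ (p─⊥≡p (A x)))
-- For a real parent y the update cost is definitionally 1 + weight A (fsuc x) (fsuc y).
... | fsuc y = cbmParent-closer-than-root cbm px

mainTheorem4 : (m n : ℕ) (A : BinMatrix m n) (p : Parent m) →
               IsCBMTree A p → cbmCost A p ≤ nnzMat A
mainTheorem4 m n A p cbm = Σ-mono-≤ (updateCost-≤-nnz cbm)
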